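{- Let $q$ be a prime power, $f$ a polynomial over $\mathrm{GF}(q)$, and $k$ an integer with $2\le k\le q$. If $|\hat{\mathcal{B}}_{(f,k)}|>1$, then the incidence structure $\hat{\mathbf{D}}(f,k)=(\mathrm{GF}(q),\hat{\mathcal{B}}_{(f,k)})$ is a $2$-$(q,k,\lambda)$ design for some $\lambda$.
   Context: For a polynomial $f$ over $\mathrm{GF}(q)$ (viewed as a function $\mathrm{GF}(q)\to\mathrm{GF}(q)$) and $(a,b,c)\in\mathrm{GF}(q)^3$, put $\hat{B}_{(f,a,b,c)}=\{af(x)+bx+c: x\in\mathrm{GF}(q)\}$. For an integer $k$ with $2\le k\le q$, $\hat{\mathcal{B}}_{(f,k)}=\{\hat{B}_{(f,a,b,c)}: |\hat{B}_{(f,a,b,c)}|=k,\ (a,b,c)\in\mathrm{GF}(q)^3\}$ (a set, so each block appears once), and $\hat{\mathbf{D}}(f,k)$ is the incidence structure with point set $\mathrm{GF}(q)$, block set $\hat{\mathcal{B}}_{(f,k)}$ and incidence given by membership. A $t$-$(v,k,\lambda)$ design is a pair $(\mathcal{P},\mathcal{B})$ with $|\mathcal{P}|=v$ and $\mathcal{B}$ a set of $k$-subsets of $\mathcal{P}$ such that every $t$-subset of $\mathcal{P}$ is contained in exactly $\lambda$ members of $\mathcal{B}$. -}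

module Defs where

open import Level using (0ℓ)
open import Data.Nat using (ℕ; _≤_; _<_)
open import Data.Fin using (Fin)
open import Data.Fin.Subset using (Subset; ∣_∣; _∈_)
open import Data.Fin.Subset.Properties using (_∈?_)
open import Data.Bool using (Bool; true; false)
open import Data.Vec using (tabulate)
open import Data.Vec.Properties using (≡-dec)
open import Data.List using (List; []; _∷_; concatMap; map; filter; deduplicate; length; allFin)
open import Data.List.Relation.Unary.Any using (any?)
open import Data.Product using (Σ; _×_; _,_; ∃)
open import Relation.Binary.PropositionalEquality using (_≡_; _≢_)
open import Relation.Nullary using (does; ¬_)
open import Relation.Nullary.Decidable using (_×-dec_)
open import Algebra.Structures using (IsCommutativeRing)
import Data.Fin.Properties as FinP
import Data.Nat.Properties as NatP
import Data.Bool.Properties as BoolP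

-- A finite field with exactly q elements, realised on the carrier Fin q
-- (so q is necessarily a prime power, and the field is GF(q) up to iso).
record FiniteField (q : ℕ) : Set where
  field
    _+_ _*_ : Fin q → Fin q → Fin q
    -_      : Fin q → Fin q
    0# 1#   : Fin q
    isCommutativeRing : IsCommutativeRing _≡_ _+_ _*_ -_ 0# 1#
    0≢1     : 0# ≢ 1#
    inverse : ∀ x → x ≢ 0# → ∃ λ y → x * y ≡ 1#

module _ {q : ℕ} (F : FiniteField q) where
  open FiniteField F

  -- Polynomials over GF(q) as coefficient lists (constant term first).
  Poly : Set
  Poly = List (Fin q)

  eval : Poly → Fin q → Fin q
  eval []       x = 0#
  eval (c ∷ cs) x = c + (x * eval cs x)

  -- B̂_(f,a,b,c) = { a f(x) + b x + c : x ∈ GF(q) } as a subset of GF(q).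
  blockHat : Poly → Fin q → Fin q → Fin q → Subset q
  blockHat f a b c =
    tabulate (λ y → does (any? (λ x → FinP._≟_ (((a * eval f x) + (b * x)) + c) y) (allFin q)))

  triples : List (Fin q × Fin q × Fin q)
  triples = concatMap (λ a → concatMap (λ b → map (λ c → (a , b , c)) (allFin q)) (allFin q)) (allFin q)

  -- The block set B̂_(f,k), as a duplicate-free list (a set: each block once).
  blocksHat : Poly → ℕ → List (Subset q)
  blocksHat f k =
    deduplicate (≡-dec BoolP._≟_)
      (filter (λ B → ∣ B ∣ NatP.≟ k)
        (map (λ { (a , b , c) → blockHat f a b c }) triples))

  pairCount : Poly → ℕ → Fin q → Fin q → ℕ
  pairCount f k x y = length (filter (λ B → (x ∈? B) ×-dec (y ∈? B)) (blocksHat f k))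

  -- D̂(f,k) is a 2-(q,k,λ) design: every block is a k-subset (true by
  -- construction of blocksHat) and every 2-subset {x,y} lies in exactly λ blocks.
  Is2Design : Poly → ℕ → ℕ → Set
  Is2Design f k λ′ = ∀ x y → x ≢ y → pairCount f k x y ≡ λ′

module Submission where

-- The affine maps z ↦ γ z + δ (γ ≠ 0) of GF(q) permute the
-- family of all sets B̂(f,a,b,c): the image of B̂(f,a,b,c) is B̂(f, γa, γb, γc + δ).
-- A permutation preserves cardinalities, hence it permutes the blocks of size k,
-- and it sends the blocks through x and y injectively to blocks through π x and
-- π y; so the pair count of (x,y) is at most that of (π x, π y).  The affine group
-- is 2-transitive: for x ≠ y there are affine maps carrying (x,y) to (0,1) and
-- (0,1) to (x,y).  Hence every pair of distinct points lies in exactly as many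
-- blocks as (0,1), i.e. D̂(f,k) is a 2-design with λ the pair count of (0,1).

open import Defs
open import Data.Nat using (ℕ; zero; suc; _≤_; _<_; z≤n; s≤s)
open import Data.Nat.Properties using (≤-trans; ≤-reflexive; ≤-antisym; module ≤-Reasoning)
import Data.Nat.Properties as NatP
open import Data.Bool using (true; false)
import Data.Bool.Properties as BoolP
open import Data.Fin using (Fin)
import Data.Fin as Fin
import Data.Fin.Properties as FinP
open import Data.Fin.Subset using (Subset; ∣_∣; _∈_; inside; outside)
open import Data.Fin.Subset.Properties using (_∈?_)
open import Data.Fin.Permutation using (Permutation′; permutation; _⟨$⟩ʳ_; _⟨$⟩ˡ_; inverseˡ; inverseʳ; flip)
open import Data.Vec using ([]; _∷_; lookup; tabulate)
open import Data.Vec.Properties using (≡-dec; lookup∘tabulate; tabulate∘lookup; tabulate-cong; []=⇒lookup; lookup⇒[]=)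
import Data.List as List
open import Data.List using (List; []; _∷_; length; filter; map; allFin; deduplicate)
open import Data.List.Properties using (filter-notAll; length-map)
open import Data.List.Membership.Propositional using () renaming (_∈_ to _∈ˡ_)
open import Data.List.Membership.Propositional.Properties
  using (∈-filter⁺; ∈-filter⁻; ∈-map⁺; ∈-map⁻; ∈-allFin; ∈-concat⁺′; ∈-deduplicate⁺; ∈-deduplicate⁻)
open import Data.List.Relation.Binary.Subset.Propositional using (_⊆_)
open import Data.List.Relation.Unary.Any using (here; there; any?)
import Data.List.Relation.Unary.Any as Any
import Data.List.Relation.Unary.All as All
open import Data.List.Relation.Unary.AllPairs using (_∷_)
open import Data.List.Relation.Unary.Unique.Propositional using (Unique)
import Data.List.Relation.Unary.Unique.Propositional.Properties as Unique
import Data.List.Relation.Unary.Unique.DecPropositional.Properties as DecUnique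
open import Data.Product using (∃; _×_; _,_; proj₁; proj₂)
open import Algebra.Bundles using (CommutativeRing)
open import Function using (_∘_; id)
open import Function.Bundles using (mk⇔)
open import Level using (0ℓ)
open import Relation.Binary.Definitions using (DecidableEquality)
open import Relation.Binary.PropositionalEquality
open import Relation.Nullary using (does; ¬?)
open import Relation.Nullary.Decidable using (_×-dec_; does-⇔)
open import Relation.Unary using (Pred; Decidable)

module _ {A : Set} (_≟_ : DecidableEquality A) where

  unique-⊆⇒length-≤ : ∀ {xs ys : List A} → Unique xs → xs ⊆ ys → length xs ≤ length ys
  unique-⊆⇒length-≤ {[]}     _           _  = z≤n
  unique-⊆⇒length-≤ {x ∷ xs} {ys} (x∉xs ∷ xs!) xs⊆ys =
    ≤-trans (s≤s (unique-⊆⇒length-≤ xs! xs⊆ys-x)) (filter-notAll (≢x?) ys x∈ys)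
    where
    ≢x? : Decidable (_≢ x)
    ≢x? z = ¬? (z ≟ x)
    x∈ys = Any.map (λ x≡z z≢x → z≢x (sym x≡z)) (xs⊆ys (here refl))
    xs⊆ys-x : xs ⊆ filter ≢x? ys
    xs⊆ys-x z∈xs = ∈-filter⁺ ≢x? (xs⊆ys (there z∈xs)) (λ { refl → All.lookup x∉xs z∈xs refl })

  length-filter-deduplicate-mono :
    (L : List A) {P Q : Pred A 0ℓ} (P? : Decidable P) (Q? : Decidable Q) (φ : A → A) →
    (∀ {x y} → φ x ≡ φ y → x ≡ y) →
    (∀ {x} → x ∈ˡ L → P x → φ x ∈ˡ L × Q (φ x)) →
    length (filter P? (deduplicate _≟_ L)) ≤ length (filter Q? (deduplicate _≟_ L))
  length-filter-deduplicate-mono L P? Q? φ φ-injective φ-maps =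
    ≤-trans (≤-reflexive (sym (length-map φ (filter P? (deduplicate _≟_ L)))))
            (unique-⊆⇒length-≤ φ[Ps]! φ[Ps]⊆Qs)
    where
    φ[Ps]! = Unique.map⁺ φ-injective (Unique.filter⁺ P? (DecUnique.deduplicate-! _≟_ L))
    φ[Ps]⊆Qs : map φ (filter P? (deduplicate _≟_ L)) ⊆ filter Q? (deduplicate _≟_ L)
    φ[Ps]⊆Qs y∈ with ∈-map⁻ φ y∈
    ... | x , x∈Ps , refl with ∈-filter⁻ P? x∈Ps
    ... | x∈L′ , Px with φ-maps (∈-deduplicate⁻ _≟_ L x∈L′) Px
    ... | φx∈L , Qφx = ∈-filter⁺ Q? (∈-deduplicate⁺ _≟_ φx∈L) Qφx

members : ∀ {n} → Subset n → List (Fin n)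
members {n} B = filter (_∈? B) (allFin n)

members-unique : ∀ {n} (B : Subset n) → Unique (members B)
members-unique {n} B = Unique.filter⁺ (_∈? B) (Unique.allFin⁺ n)

∈-members⁺ : ∀ {n} {B : Subset n} {x} → x ∈ B → x ∈ˡ members B
∈-members⁺ {B = B} {x} x∈B = ∈-filter⁺ (_∈? B) (∈-allFin x) x∈B

∈-members⁻ : ∀ {n} {B : Subset n} {x} → x ∈ˡ members B → x ∈ B
∈-members⁻ {n} {B} x∈ = proj₂ (∈-filter⁻ (_∈? B) {xs = allFin n} x∈)

length-filter-∈-tail : ∀ {m n} s (B : Subset n) (g : Fin m → Fin n) →
  length (filter (_∈? s ∷ B) (List.tabulate (Fin.suc ∘ g))) ≡ length (filter (_∈? B) (List.tabulate g))
length-filter-∈-tail {zero}  s B g = refl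
length-filter-∈-tail {suc m} s B g with does (g Fin.zero ∈? B)
... | true  = cong suc (length-filter-∈-tail s B (g ∘ Fin.suc))
... | false = length-filter-∈-tail s B (g ∘ Fin.suc)

∣∣≡length-members : ∀ {n} (B : Subset n) → ∣ B ∣ ≡ length (members B)
∣∣≡length-members []            = refl
∣∣≡length-members (inside ∷ B)  =
  cong suc (trans (∣∣≡length-members B) (sym (length-filter-∈-tail inside B id)))
∣∣≡length-members (outside ∷ B) =
  trans (∣∣≡length-members B) (sym (length-filter-∈-tail outside B id))

image : ∀ {n} → Permutation′ n → Subset n → Subset n
image π B = tabulate (λ w → lookup B (π ⟨$⟩ˡ w))

module _ {n : ℕ} (π : Permutation′ n) where

  lookup-image : ∀ B x → lookup (image π B) (π ⟨$⟩ʳ x) ≡ lookup B x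
  lookup-image B x = trans (lookup∘tabulate _ (π ⟨$⟩ʳ x)) (cong (lookup B) (inverseˡ π))

  ∈-image⁺ : ∀ {B x} → x ∈ B → π ⟨$⟩ʳ x ∈ image π B
  ∈-image⁺ {B} {x} x∈B = lookup⇒[]= _ (image π B) (trans (lookup-image B x) ([]=⇒lookup x∈B))

  image-flip : ∀ B → image (flip π) (image π B) ≡ B
  image-flip B = trans (tabulate-cong (lookup-image B)) (tabulate∘lookup B)

  image-injective : ∀ {B C} → image π B ≡ image π C → B ≡ C
  image-injective {B} {C} eq =
    trans (sym (image-flip B)) (trans (cong (image (flip π)) eq) (image-flip C))

  ⟨$⟩ʳ-injective : ∀ {x y} → π ⟨$⟩ʳ x ≡ π ⟨$⟩ʳ y → x ≡ y
  ⟨$⟩ʳ-injective eq = trans (sym (inverseˡ π)) (trans (cong (π ⟨$⟩ˡ_) eq) (inverseˡ π))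

  -- π maps the members of B injectively into the members of π[B].
  ∣∣≤∣image∣ : ∀ B → ∣ B ∣ ≤ ∣ image π B ∣
  ∣∣≤∣image∣ B = begin
    ∣ B ∣                                  ≡⟨ ∣∣≡length-members B ⟩
    length (members B)                     ≡⟨ length-map (π ⟨$⟩ʳ_) (members B) ⟨
    length (map (π ⟨$⟩ʳ_) (members B))    ≤⟨ unique-⊆⇒length-≤ FinP._≟_ π[B]! π[B]⊆ ⟩
    length (members (image π B))           ≡⟨ ∣∣≡length-members (image π B) ⟨
    ∣ image π B ∣                          ∎
    where
    open ≤-Reasoning
    π[B]! = Unique.map⁺ ⟨$⟩ʳ-injective (members-unique B)
    π[B]⊆ : map (π ⟨$⟩ʳ_) (members B) ⊆ members (image π B)
    π[B]⊆ y∈ with ∈-map⁻ (π ⟨$⟩ʳ_) y∈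
    ... | x , x∈B , refl = ∈-members⁺ (∈-image⁺ (∈-members⁻ x∈B))

∣image∣≡∣∣ : ∀ {n} (π : Permutation′ n) B → ∣ image π B ∣ ≡ ∣ B ∣
∣image∣≡∣∣ π B = ≤-antisym
  (subst (λ C → ∣ image π B ∣ ≤ ∣ C ∣) (image-flip π B) (∣∣≤∣image∣ (flip π) (image π B)))
  (∣∣≤∣image∣ π B)

module PairCounts {n : ℕ} (k : ℕ) (L : List (Subset n)) where

  blocksOfSize : List (Subset n)
  blocksOfSize = deduplicate (≡-dec BoolP._≟_) (filter (λ B → ∣ B ∣ NatP.≟ k) L)

  pairsThrough : Fin n → Fin n → ℕ
  pairsThrough x y = length (filter (λ B → (x ∈? B) ×-dec (y ∈? B)) blocksOfSize)

  -- If taking images under π maps L into itself, then π sends the k-blocks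
  -- through x and y injectively to k-blocks through π x and π y.
  pairsThrough-mono : (π : Permutation′ n) → (∀ {B} → B ∈ˡ L → image π B ∈ˡ L) →
    ∀ x y → pairsThrough x y ≤ pairsThrough (π ⟨$⟩ʳ x) (π ⟨$⟩ʳ y)
  pairsThrough-mono π L-closed x y =
    length-filter-deduplicate-mono (≡-dec BoolP._≟_) _ _ _ (image π) (image-injective π) maps
    where
    maps : ∀ {B} → B ∈ˡ filter (λ B → ∣ B ∣ NatP.≟ k) L → x ∈ B × y ∈ B →
           image π B ∈ˡ filter (λ B → ∣ B ∣ NatP.≟ k) L × (π ⟨$⟩ʳ x ∈ image π B × π ⟨$⟩ʳ y ∈ image π B)
    maps {B} B∈ (x∈B , y∈B) with ∈-filter⁻ (λ B → ∣ B ∣ NatP.≟ k) {xs = L} B∈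
    ... | B∈L , ∣B∣≡k =
      ∈-filter⁺ (λ B → ∣ B ∣ NatP.≟ k) (L-closed B∈L) (trans (∣image∣≡∣∣ π B) ∣B∣≡k)
      , ∈-image⁺ π x∈B , ∈-image⁺ π y∈B

module AffineMaps {q : ℕ} (F : FiniteField q) where
  open FiniteField F using (isCommutativeRing; inverse)

  -- The field as a library commutative ring, for its operator fixities,
  -- subtraction and derived laws.
  commutativeRing : CommutativeRing _ _
  commutativeRing = record { isCommutativeRing = isCommutativeRing }

  open CommutativeRing commutativeRing public using (_+_; _*_; -_; _-_; 0#; 1#)
  open CommutativeRing commutativeRing
    using (+-assoc; *-assoc; *-comm; distribˡ; +-identityˡ; *-identityˡ; *-identityʳ; zeroʳ; -‿inverseʳ; +-group; ring)
  open import Algebra.Properties.Group +-group using (//-rightDividesˡ; //-rightDividesʳ; x∙y⁻¹≈ε⇒x≈y)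
  open import Algebra.Properties.Ring ring using (x[y-z]≈xy-xz)
  open ≡-Reasoning

  cancelˡ : ∀ {γ γ⁻¹} → γ * γ⁻¹ ≡ 1# → ∀ z → γ * (γ⁻¹ * z) ≡ z
  cancelˡ {γ} {γ⁻¹} γγ⁻¹≡1 z = begin
    γ * (γ⁻¹ * z) ≡⟨ *-assoc γ γ⁻¹ z ⟨
    (γ * γ⁻¹) * z ≡⟨ cong (_* z) γγ⁻¹≡1 ⟩
    1# * z        ≡⟨ *-identityˡ z ⟩
    z             ∎

  inverse-comm : ∀ {γ γ⁻¹} → γ * γ⁻¹ ≡ 1# → γ⁻¹ * γ ≡ 1#
  inverse-comm {γ} {γ⁻¹} γγ⁻¹≡1 = trans (*-comm γ⁻¹ γ) γγ⁻¹≡1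

  difference-invertible : ∀ {x y} → x ≢ y → ∃ λ d⁻¹ → (y - x) * d⁻¹ ≡ 1#
  difference-invertible {x} {y} x≢y = inverse (y - x) (λ y-x≡0 → x≢y (sym (x∙y⁻¹≈ε⇒x≈y y x y-x≡0)))

  affine-value : ∀ γ δ a e b x c →
    γ * (a * e + b * x + c) + δ ≡ (γ * a) * e + (γ * b) * x + (γ * c + δ)
  affine-value γ δ a e b x c = begin
    γ * (a * e + b * x + c) + δ                   ≡⟨ cong (_+ δ) (distribˡ γ (a * e + b * x) c) ⟩
    γ * (a * e + b * x) + γ * c + δ               ≡⟨ cong (λ t → t + γ * c + δ) (distribˡ γ (a * e) (b * x)) ⟩
    γ * (a * e) + γ * (b * x) + γ * c + δ         ≡⟨ cong₂ (λ s t → s + t + γ * c + δ) (*-assoc γ a e) (*-assoc γ b x) ⟨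
    (γ * a) * e + (γ * b) * x + γ * c + δ         ≡⟨ +-assoc _ (γ * c) δ ⟩
    (γ * a) * e + (γ * b) * x + (γ * c + δ)       ∎

  affine : (γ γ⁻¹ δ : Fin q) → γ * γ⁻¹ ≡ 1# → Permutation′ q
  affine γ γ⁻¹ δ γγ⁻¹≡1 = permutation (λ z → γ * z + δ) (λ w → γ⁻¹ * (w - δ)) to∘from from∘to
    where
    to∘from : ∀ w → γ * (γ⁻¹ * (w - δ)) + δ ≡ w
    to∘from w = trans (cong (_+ δ) (cancelˡ γγ⁻¹≡1 (w - δ))) (//-rightDividesˡ δ w)
    from∘to : ∀ z → γ⁻¹ * (γ * z + δ - δ) ≡ z
    from∘to z = trans (cong (γ⁻¹ *_) (//-rightDividesʳ δ (γ * z))) (cancelˡ (inverse-comm γγ⁻¹≡1) z)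

  record AffineTransfer (x y x′ y′ : Fin q) : Set where
    field
      γ γ⁻¹ δ : Fin q
      γγ⁻¹≡1  : γ * γ⁻¹ ≡ 1#
      maps-x  : γ * x + δ ≡ x′
      maps-y  : γ * y + δ ≡ y′

  fromBase : ∀ {x y} → x ≢ y → AffineTransfer 0# 1# x y
  fromBase {x} {y} x≢y = record
    { γ = y - x ; γ⁻¹ = proj₁ (difference-invertible x≢y) ; δ = x
    ; γγ⁻¹≡1 = proj₂ (difference-invertible x≢y)
    ; maps-x = trans (cong (_+ x) (zeroʳ (y - x))) (+-identityˡ x)
    ; maps-y = trans (cong (_+ x) (*-identityʳ (y - x))) (//-rightDividesˡ x y)
    }

  toBase : ∀ {x y} → x ≢ y → AffineTransfer x y 0# 1#
  toBase {x} {y} x≢y = record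
    { γ = d⁻¹ ; γ⁻¹ = y - x ; δ = - (d⁻¹ * x)
    ; γγ⁻¹≡1 = inverse-comm dd⁻¹≡1
    ; maps-x = -‿inverseʳ (d⁻¹ * x)
    ; maps-y = begin
        d⁻¹ * y - d⁻¹ * x ≡⟨ x[y-z]≈xy-xz d⁻¹ y x ⟨
        d⁻¹ * (y - x)     ≡⟨ inverse-comm dd⁻¹≡1 ⟩
        1#                ∎
    }
    where
    d⁻¹ = proj₁ (difference-invertible x≢y)
    dd⁻¹≡1 = proj₂ (difference-invertible x≢y)

module Blocks {q : ℕ} (F : FiniteField q) (f : Poly F) where
  open AffineMaps F

  blockOf : Fin q × Fin q × Fin q → Subset q
  blockOf (a , b , c) = blockHat F f a b c

  allBlocks : List (Subset q)
  allBlocks = map blockOf (triples F)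

  ∈-triples : ∀ a b c → (a , b , c) ∈ˡ triples F
  ∈-triples a b c = ∈-concat⁺′ (∈-concat⁺′ (∈-map⁺ _ (∈-allFin c)) (∈-map⁺ _ (∈-allFin b))) (∈-map⁺ _ (∈-allFin a))

  image-affine-block : ∀ γ γ⁻¹ δ (γγ⁻¹≡1 : γ * γ⁻¹ ≡ 1#) a b c →
    image (affine γ γ⁻¹ δ γγ⁻¹≡1) (blockHat F f a b c) ≡ blockHat F f (γ * a) (γ * b) (γ * c + δ)
  image-affine-block γ γ⁻¹ δ γγ⁻¹≡1 a b c = tabulate-cong λ w →
    trans (lookup∘tabulate _ (π ⟨$⟩ˡ w)) (does-⇔ (mk⇔ (Any.map (forth w)) (Any.map (back w)))
      (any? (λ x → a * eval F f x + b * x + c FinP.≟ π ⟨$⟩ˡ w) (allFin q))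
      (any? (λ x → (γ * a) * eval F f x + (γ * b) * x + (γ * c + δ) FinP.≟ w) (allFin q)))
    where
    π = affine γ γ⁻¹ δ γγ⁻¹≡1
    forth : ∀ w {x} → a * eval F f x + b * x + c ≡ π ⟨$⟩ˡ w →
            (γ * a) * eval F f x + (γ * b) * x + (γ * c + δ) ≡ w
    forth w {x} eq =
      trans (sym (affine-value γ δ a (eval F f x) b x c)) (trans (cong (π ⟨$⟩ʳ_) eq) (inverseʳ π))
    back : ∀ w {x} → (γ * a) * eval F f x + (γ * b) * x + (γ * c + δ) ≡ w →
           a * eval F f x + b * x + c ≡ π ⟨$⟩ˡ w
    back w {x} eq =
      trans (sym (inverseˡ π)) (cong (π ⟨$⟩ˡ_) (trans (affine-value γ δ a (eval F f x) b x c) eq))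

  allBlocks-closed : ∀ γ γ⁻¹ δ (γγ⁻¹≡1 : γ * γ⁻¹ ≡ 1#) {B} →
    B ∈ˡ allBlocks → image (affine γ γ⁻¹ δ γγ⁻¹≡1) B ∈ˡ allBlocks
  allBlocks-closed γ γ⁻¹ δ γγ⁻¹≡1 B∈ with ∈-map⁻ blockOf B∈
  ... | (a , b , c) , _ , refl =
    subst (_∈ˡ allBlocks) (sym (image-affine-block γ γ⁻¹ δ γγ⁻¹≡1 a b c))
          (∈-map⁺ blockOf (∈-triples (γ * a) (γ * b) (γ * c + δ)))

-- pairCount F f k is, by definition, the pair count of the k-blocks among
-- allBlocks; an affine transfer of (x , y) to (x′ , y′) can only increase it.
pairCount-transfer : ∀ {q} (F : FiniteField q) (f : Poly F) (k : ℕ) {x y x′ y′} →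
  AffineMaps.AffineTransfer F x y x′ y′ → pairCount F f k x y ≤ pairCount F f k x′ y′
pairCount-transfer F f k {x} {y} T =
  subst₂ (λ u v → pairCount F f k x y ≤ pairCount F f k u v) maps-x maps-y
    (PairCounts.pairsThrough-mono k (Blocks.allBlocks F f) (AffineMaps.affine F γ γ⁻¹ δ γγ⁻¹≡1)
       (Blocks.allBlocks-closed F f γ γ⁻¹ δ γγ⁻¹≡1) x y)
  where open AffineMaps.AffineTransfer T

-- Every pair of distinct points lies in as many blocks as the pair (0 , 1),
-- since affine maps carry each of these pairs to the other.
mainTheorem17 : (q : ℕ) (F : FiniteField q) (f : Poly F) (k : ℕ) → 2 ≤ k → k ≤ q →
    1 < length (blocksHat F f k) → ∃ λ lam → Is2Design F f k lam
mainTheorem17 q F f k _ _ _ = pairCount F f k 0# 1# , λ x y x≢y →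
  ≤-antisym (pairCount-transfer F f k (toBase x≢y)) (pairCount-transfer F f k (fromBase x≢y))
  where open AffineMaps F using (0#; 1#; toBase; fromBase)
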